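{- Let $k\ge 0$ be an integer and $n=48k+38$. Define $c_3(r)\in\mathbb{Z}_n$ for $0\le r\le n-1$ as follows (all arithmetic modulo $n$): for $0\le i\le 12k+9$, $c_3(2i)=30k+24+i(12k+11)$; for $0\le i\le 12k+8$, $c_3(2i+1)=24k+20+i(12k+11)$ (this defines $c_3(r)$ for $0\le r\le 24k+18$); and for $0\le r\le 24k+18$, $c_3(n-1-r)=n-1-c_3(r)$. Let ${\cal L}_3=[l_3(r,j)]$ be the $n\times n$ array with $l_3(r,j)\equiv c_3(r)+j \pmod n$ for $0\le r,j\le n-1$. Then ${\cal L}_3$ is a Latin square of order $n$.
   Context: A Latin square of order $n$ is an $n\times n$ array in which each row and each column contains each of the symbols $0,1,\dots,n-1$ exactly once. -}

module Defs where

open import Data.Nat using (ℕ; zero; suc; _+_; _*_; _∸_; _≤?_; _<_)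
open import Data.Nat.DivMod using (_%_; _/_)
open import Data.Fin using (Fin; toℕ; fromℕ<)
open import Data.Nat.DivMod using (m%n<n)
open import Data.Product using (∃!)
open import Relation.Binary.PropositionalEquality using (_≡_)
open import Relation.Nullary using (yes; no)

-- the order n = 48k+38 (written suc (48k+37) so NonZero is found by instance search)
order : ℕ → ℕ
order k = suc (48 * k + 37)

c3-half : ℕ → ℕ → ℕ
c3-half k r with r % 2
... | zero  = (30 * k + 24 + (r / 2) * (12 * k + 11)) % (order k)
... | suc _ = (24 * k + 20 + (r / 2) * (12 * k + 11)) % (order k)

c3 : ℕ → ℕ → ℕ
c3 k r with r ≤? 24 * k + 18
... | yes _ = c3-half k r
... | no  _ = (order k ∸ 1) ∸ c3-half k ((order k ∸ 1) ∸ r)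

L3 : (k : ℕ) → Fin (order k) → Fin (order k) → Fin (order k)
L3 k r j = fromℕ< (m%n<n (c3 k (toℕ r) + toℕ j) (order k))

IsLatinSquare : (n : ℕ) → (Fin n → Fin n → Fin n) → Set
IsLatinSquare n L =
  ((r s : Fin n) → ∃! _≡_ (λ j → L r j ≡ s)) ×' ((j s : Fin n) → ∃! _≡_ (λ r → L r j ≡ s))
  where open import Data.Product renaming (_×_ to _×'_)

-- Every row of L₃ is a cyclic shift of 0, …, n − 1, so L₃ is Latin as soon as
-- c₃ is injective modulo n.  The common difference 12k + 11 of the progressions
-- defining c₃ has inverse u = 8k + 7 modulo n, so the affine map x ↦ u x + 4k + 3
-- sends c₃(2i) to 24k + 19 + i and c₃(2i + 1) to 36k + 29 + i: on the first half
-- it turns c₃ into an injection into {24k + 19, …, n − 1}.  Since 2(4k + 3) = u − 1,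
-- the affine map commutes with x ↦ n − 1 − x, which carries the second half of c₃
-- injectively into {0, …, 24k + 18}.
module Submission where

open import Defs
open import Data.Nat using (ℕ; zero; suc; _+_; _*_; _∸_; _≤_; _<_; _≤?_; NonZero)
open import Data.Nat.Properties hiding (_≟_)
open import Data.Nat.DivMod
open import Data.Nat.Tactic.RingSolver using (solve-∀)
open import Data.Fin using (Fin; toℕ; fromℕ<; punchOut; _≟_)
open import Data.Fin.Properties using (toℕ-injective; toℕ-fromℕ<; toℕ<n; punchOut-injective; any?; <⇒notInjective)
open import Data.Product using (∃; ∃!; _×_; _,_; proj₁; proj₂)
open import Function.Definitions using (Injective)
open import Data.Empty using (⊥-elim)
open import Relation.Nullary using (¬_; yes; no; contradiction)
open import Relation.Binary.PropositionalEquality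

injective⇒surjective : ∀ {n} {f : Fin n → Fin n} → Injective _≡_ _≡_ f → ∀ s → ∃ λ i → f i ≡ s
injective⇒surjective {suc m} {f} inj s with any? (λ i → f i ≟ s)
... | yes hit  = hit
... | no  miss = ⊥-elim (<⇒notInjective (n<1+n m) g-injective)
  where
  g : Fin (suc m) → Fin m
  g i = punchOut (λ s≡fi → miss (i , sym s≡fi))

  g-injective : Injective _≡_ _≡_ g
  g-injective {i} {j} gi≡gj =
    inj (punchOut-injective {i = s} (λ s≡fi → miss (i , sym s≡fi)) (λ s≡fj → miss (j , sym s≡fj)) gi≡gj)

injective⇒∃! : ∀ {n} {f : Fin n → Fin n} → Injective _≡_ _≡_ f → ∀ s → ∃! _≡_ (λ i → f i ≡ s)
injective⇒∃! inj s with i , fi≡s ← injective⇒surjective inj s =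
  i , fi≡s , λ fj≡s → inj (trans fi≡s (sym fj≡s))

module _ {n : ℕ} .{{_ : NonZero n}} where

  [a*[x%n]+b]%n≡[a*x+b]%n : ∀ a b x → (a * (x % n) + b) % n ≡ (a * x + b) % n
  [a*[x%n]+b]%n≡[a*x+b]%n a b x = begin
    (a * (x % n) + b) % n                   ≡⟨ [m+kn]%n≡m%n _ (a * (x / n)) n ⟨
    (a * (x % n) + b + a * (x / n) * n) % n ≡⟨ cong (_% n) (regroup a b (x % n) (x / n) n) ⟩
    (a * (x % n + x / n * n) + b) % n       ≡⟨ cong (λ y → (a * y + b) % n) (m≡m%n+[m/n]*n x n) ⟨
    (a * x + b) % n                         ∎
    where
    open ≡-Reasoning
    regroup : ∀ a b p q n → a * p + b + a * q * n ≡ a * (p + q * n) + b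
    regroup = solve-∀

  affine-progression : ∀ {a b x d i c} t q → a * d ≡ 1 + t * n → a * x + b ≡ c + q * n → c + i < n →
                       (a * ((x + i * d) % n) + b) % n ≡ c + i
  affine-progression {a} {b} {x} {d} {i} {c} t q ad≡1 ax+b≡c c+i<n = begin
    (a * ((x + i * d) % n) + b) % n     ≡⟨ [a*[x%n]+b]%n≡[a*x+b]%n a b (x + i * d) ⟩
    (a * (x + i * d) + b) % n           ≡⟨ cong (_% n) (expand a b x i d) ⟩
    ((a * x + b) + i * (a * d)) % n     ≡⟨ cong₂ (λ y z → (y + i * z) % n) ax+b≡c ad≡1 ⟩
    ((c + q * n) + i * (1 + t * n)) % n ≡⟨ cong (_% n) (collect c q n i t) ⟩
    (c + i + (q + i * t) * n) % n       ≡⟨ [m+kn]%n≡m%n (c + i) (q + i * t) n ⟩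
    (c + i) % n                         ≡⟨ m<n⇒m%n≡m c+i<n ⟩
    c + i                               ∎
    where
    open ≡-Reasoning
    expand : ∀ a b x i d → a * (x + i * d) + b ≡ (a * x + b) + i * (a * d)
    expand = solve-∀
    collect : ∀ c q n i t → (c + q * n) + i * (1 + t * n) ≡ c + i + (q + i * t) * n
    collect = solve-∀

  %-cancelˡ-+ : ∀ c {a b} → (c + a) % n ≡ (c + b) % n → a % n ≡ b % n
  %-cancelˡ-+ c {a} {b} eq = begin
    a % n                     ≡⟨ [d+[c+x]]%n≡x%n a ⟨
    (d + (c + a)) % n         ≡⟨ %-distribˡ-+ d (c + a) n ⟩
    (d % n + (c + a) % n) % n ≡⟨ cong (λ y → (d % n + y) % n) eq ⟩
    (d % n + (c + b) % n) % n ≡⟨ %-distribˡ-+ d (c + b) n ⟨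
    (d + (c + b)) % n         ≡⟨ [d+[c+x]]%n≡x%n b ⟩
    b % n                     ∎
    where
    open ≡-Reasoning
    d = n ∸ c % n
    regroup : ∀ d p q x → d + (p + q + x) ≡ x + (d + p + q)
    regroup = solve-∀
    -- d + c is a multiple of n
    [d+[c+x]]%n≡x%n : ∀ x → (d + (c + x)) % n ≡ x % n
    [d+[c+x]]%n≡x%n x = begin
      (d + (c + x)) % n                      ≡⟨ cong (λ y → (d + (y + x)) % n) (m≡m%n+[m/n]*n c n) ⟩
      (d + (c % n + c / n * n + x)) % n      ≡⟨ cong (_% n) (regroup d (c % n) (c / n * n) x) ⟩
      (x + (d + c % n + c / n * n)) % n      ≡⟨ cong (λ y → (x + (y + c / n * n)) % n) (m∸n+n≡m (<⇒≤ (m%n<n c n))) ⟩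
      (x + suc (c / n) * n) % n              ≡⟨ [m+kn]%n≡m%n x (suc (c / n)) n ⟩
      x % n                                  ∎

  %-cancelʳ-+ : ∀ c {a b} → (a + c) % n ≡ (b + c) % n → a % n ≡ b % n
  %-cancelʳ-+ c {a} {b} eq = %-cancelˡ-+ c (subst₂ (λ x y → x % n ≡ y % n) (+-comm a c) (+-comm b c) eq)

m%[1+n]≡n⇒m≡n : ∀ {m n} → m ≤ n + n → m % suc n ≡ n → m ≡ n
m%[1+n]≡n⇒m≡n {m} {n} m≤2n m%[1+n]≡n with m / suc n | m≡m%n+[m/n]*n m (suc n)
... | zero  | m≡ = trans m≡ (trans (+-identityʳ _) m%[1+n]≡n)
... | suc q | m≡ = contradiction m≤2n (<⇒≱ (begin-strict
  n + n                     <⟨ +-monoʳ-< n (m≤m+n (suc n) (q * suc n)) ⟩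
  n + (suc n + q * suc n)   ≡⟨ cong (_+ (suc n + q * suc n)) m%[1+n]≡n ⟨
  m % suc n + suc q * suc n ≡⟨ m≡ ⟨
  m                         ∎))
  where open ≤-Reasoning

affine-reflect : ∀ {M} a b → (a * M + (b + b)) % suc M ≡ M →
                 ∀ {x} → x ≤ M → (a * (M ∸ x) + b) % suc M ≡ M ∸ (a * x + b) % suc M
affine-reflect {M} a b aM+2b≡M {x} x≤M = begin
  p           ≡⟨ m+n∸n≡m p q ⟨
  p + q ∸ q   ≡⟨ cong (_∸ q) p+q≡M ⟩
  M ∸ q       ∎
  where
  open ≡-Reasoning
  p = (a * (M ∸ x) + b) % suc M
  q = (a * x + b) % suc M
  %-≤ : ∀ y → y % suc M ≤ M
  %-≤ y = m<1+n⇒m≤n (m%n<n y (suc M))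
  regroup : ∀ a b y x → (a * y + b) + (a * x + b) ≡ a * (y + x) + (b + b)
  regroup = solve-∀
  p+q≡M : p + q ≡ M
  p+q≡M = m%[1+n]≡n⇒m≡n (+-mono-≤ (%-≤ (a * (M ∸ x) + b)) (%-≤ (a * x + b))) (begin
    (p + q) % suc M                              ≡⟨ %-distribˡ-+ (a * (M ∸ x) + b) (a * x + b) (suc M) ⟨
    ((a * (M ∸ x) + b) + (a * x + b)) % suc M    ≡⟨ cong (_% suc M) (regroup a b (M ∸ x) x) ⟩
    (a * (M ∸ x + x) + (b + b)) % suc M          ≡⟨ cong (λ y → (a * y + (b + b)) % suc M) (m∸n+n≡m x≤M) ⟩
    (a * M + (b + b)) % suc M                    ≡⟨ aM+2b≡M ⟩
    M                                            ∎)

cyclicSquare : ∀ n .{{_ : NonZero n}} → (ℕ → ℕ) → Fin n → Fin n → Fin n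
cyclicSquare n c r j = fromℕ< (m%n<n (c (toℕ r) + toℕ j) n)

cyclicSquare-isLatin : ∀ n .{{_ : NonZero n}} (c : ℕ → ℕ) →
                       (∀ {r s} → r < n → s < n → c r % n ≡ c s % n → r ≡ s) →
                       IsLatinSquare n (cyclicSquare n c)
cyclicSquare-isLatin n c c-injective =
  (λ r → injective⇒∃! (row-injective r)) , (λ j → injective⇒∃! (column-injective j))
  where
  entry≡ : ∀ {r j r′ j′} → cyclicSquare n c r j ≡ cyclicSquare n c r′ j′ →
           (c (toℕ r) + toℕ j) % n ≡ (c (toℕ r′) + toℕ j′) % n
  entry≡ {r} {j} {r′} {j′} eq = begin
    (c (toℕ r) + toℕ j) % n      ≡⟨ toℕ-fromℕ< (m%n<n (c (toℕ r) + toℕ j) n) ⟨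
    toℕ (cyclicSquare n c r j)   ≡⟨ cong toℕ eq ⟩
    toℕ (cyclicSquare n c r′ j′) ≡⟨ toℕ-fromℕ< (m%n<n (c (toℕ r′) + toℕ j′) n) ⟩
    (c (toℕ r′) + toℕ j′) % n    ∎
    where open ≡-Reasoning

  row-injective : ∀ r → Injective _≡_ _≡_ (cyclicSquare n c r)
  row-injective r {j} {j′} eq = toℕ-injective (begin
    toℕ j      ≡⟨ m<n⇒m%n≡m (toℕ<n j) ⟨
    toℕ j % n  ≡⟨ %-cancelˡ-+ (c (toℕ r)) (entry≡ eq) ⟩
    toℕ j′ % n ≡⟨ m<n⇒m%n≡m (toℕ<n j′) ⟩
    toℕ j′     ∎)
    where open ≡-Reasoning

  column-injective : ∀ j → Injective _≡_ _≡_ (λ r → cyclicSquare n c r j)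
  column-injective j {r} {r′} eq =
    toℕ-injective (c-injective (toℕ<n r) (toℕ<n r′) (%-cancelʳ-+ (toℕ j) (entry≡ eq)))

mirror : ℕ → ℕ → (ℕ → ℕ) → ℕ → ℕ
mirror H M f r with r ≤? H
... | yes _ = f r
... | no  _ = M ∸ f (M ∸ r)

module _ {H M : ℕ} (M≤1+H+H : M ≤ suc H + H) where

  ∸-upper≤H : ∀ x → H < x → M ∸ x ≤ H
  ∸-upper≤H _ H<x = ≤-trans (∸-monoʳ-≤ M H<x) (m≤n+o⇒m∸n≤o M (suc H) M≤1+H+H)

  upper-mirrored≤H : ∀ {f : ℕ → ℕ} → (∀ {r} → r ≤ H → H < f r × f r ≤ M) →
                     ∀ {r} → ¬ r ≤ H → M ∸ f (M ∸ r) ≤ H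
  upper-mirrored≤H {f} f-range {r} r≰H =
    ∸-upper≤H (f (M ∸ r)) (proj₁ (f-range (∸-upper≤H r (≰⇒> r≰H))))

  mirror-injective : ∀ {f : ℕ → ℕ} → (∀ {r} → r ≤ H → H < f r × f r ≤ M) →
                     (∀ {r s} → r ≤ H → s ≤ H → f r ≡ f s → r ≡ s) →
                     ∀ {r s} → r ≤ M → s ≤ M → mirror H M f r ≡ mirror H M f s → r ≡ s
  mirror-injective {f} f-range f-inj {r} {s} r≤M s≤M eq with r ≤? H | s ≤? H
  ... | yes r≤H | yes s≤H = f-inj r≤H s≤H eq
  ... | yes r≤H | no  s≰H =
    contradiction (subst (_≤ H) (sym eq) (upper-mirrored≤H f-range s≰H)) (<⇒≱ (proj₁ (f-range r≤H)))
  ... | no  r≰H | yes s≤H =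
    contradiction (subst (_≤ H) eq (upper-mirrored≤H f-range r≰H)) (<⇒≱ (proj₁ (f-range s≤H)))
  ... | no  r≰H | no  s≰H =
    ∸-cancelˡ-≡ r≤M s≤M (f-inj r′≤H s′≤H (∸-cancelˡ-≡ (proj₂ (f-range r′≤H)) (proj₂ (f-range s′≤H)) eq))
    where
    r′≤H = ∸-upper≤H r (≰⇒> r≰H)
    s′≤H = ∸-upper≤H s (≰⇒> s≰H)

  mirror-conj : ∀ {g f f′ : ℕ → ℕ} → (∀ {x} → x ≤ M → g (M ∸ x) ≡ M ∸ g x) →
                (∀ {r} → r ≤ H → f r ≤ M) → (∀ {r} → r ≤ H → g (f r) ≡ f′ r) →
                ∀ r → g (mirror H M f r) ≡ mirror H M f′ r
  mirror-conj {g} {f} {f′} g-reflect f≤M gf≡f′ r with r ≤? H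
  ... | yes r≤H = gf≡f′ r≤H
  ... | no  r≰H = begin
    g (M ∸ f (M ∸ r)) ≡⟨ g-reflect (f≤M r′≤H) ⟩
    M ∸ g (f (M ∸ r)) ≡⟨ cong (M ∸_) (gf≡f′ r′≤H) ⟩
    M ∸ f′ (M ∸ r)    ∎
    where
    open ≡-Reasoning
    r′≤H = ∸-upper≤H r (≰⇒> r≰H)

%2≡0⇒≡[/2]*2 : ∀ r → r % 2 ≡ 0 → r ≡ r / 2 * 2
%2≡0⇒≡[/2]*2 r r%2≡0 = trans (m≡m%n+[m/n]*n r 2) (cong (_+ r / 2 * 2) r%2≡0)

%2≡suc⇒≡1+[/2]*2 : ∀ r {a} → r % 2 ≡ suc a → r ≡ 1 + r / 2 * 2
%2≡suc⇒≡1+[/2]*2 r {a} r%2≡1+a = trans (m≡m%n+[m/n]*n r 2) (cong (_+ r / 2 * 2) r%2≡1)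
  where
  r%2≡1 : r % 2 ≡ 1
  r%2≡1 = trans r%2≡1+a (cong suc (n≤0⇒n≡0 (≤-pred (≤-pred (subst (_< 2) r%2≡1+a (m%n<n r 2))))))

/2-≤ : ∀ {r m} → r ≤ m * 2 → r / 2 ≤ m
/2-≤ {r} {m} r≤2m = subst (r / 2 ≤_) (m*n/n≡m m 2) (/-monoˡ-≤ 2 r≤2m)

odd-/2-< : ∀ {r m a} → r % 2 ≡ suc a → r ≤ m * 2 → r / 2 < m
odd-/2-< {r} {m} r%2≡1+a r≤2m =
  *-cancelʳ-< 2 (r / 2) m (subst (_≤ m * 2) (%2≡suc⇒≡1+[/2]*2 r r%2≡1+a) r≤2m)

[8k+7]*[12k+11]≡1+[2k+2]n : ∀ k → (8 * k + 7) * (12 * k + 11) ≡ 1 + (2 * k + 2) * suc (48 * k + 37)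
[8k+7]*[12k+11]≡1+[2k+2]n = solve-∀

affine : ℕ → ℕ → ℕ
affine k x = ((8 * k + 7) * x + (4 * k + 3)) % order k

affine-reflect-order : ∀ k {x} → x ≤ 48 * k + 37 → affine k (48 * k + 37 ∸ x) ≡ 48 * k + 37 ∸ affine k x
affine-reflect-order k = affine-reflect (8 * k + 7) (4 * k + 3) (begin
  ((8 * k + 7) * (48 * k + 37) + ((4 * k + 3) + (4 * k + 3))) % order k ≡⟨ cong (_% order k) (expand k) ⟩
  (48 * k + 37 + (8 * k + 6) * order k) % order k                      ≡⟨ [m+kn]%n≡m%n (48 * k + 37) (8 * k + 6) (order k) ⟩
  (48 * k + 37) % order k                                              ≡⟨ m<n⇒m%n≡m ≤-refl ⟩
  48 * k + 37                                                          ∎)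
  where
  open ≡-Reasoning
  expand : ∀ k → (8 * k + 7) * (48 * k + 37) + ((4 * k + 3) + (4 * k + 3)) ≡ 48 * k + 37 + (8 * k + 6) * suc (48 * k + 37)
  expand = solve-∀

σ-half : ℕ → ℕ → ℕ
σ-half k r with r % 2
... | zero  = 24 * k + 19 + r / 2
... | suc _ = 36 * k + 29 + r / 2

σ : ℕ → ℕ → ℕ
σ k = mirror (24 * k + 18) (48 * k + 37) (σ-half k)

≤24k+18⇒≤[12k+9]*2 : ∀ k {r} → r ≤ 24 * k + 18 → r ≤ (12 * k + 9) * 2
≤24k+18⇒≤[12k+9]*2 k {r} = subst (r ≤_) (double k)
  where
  double : ∀ k → 24 * k + 18 ≡ (12 * k + 9) * 2
  double = solve-∀

36k+29+[12k+9]≡order : ∀ k → 36 * k + 29 + (12 * k + 9) ≡ order k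
36k+29+[12k+9]≡order k = exact k
  where
  exact : ∀ k → 36 * k + 29 + (12 * k + 9) ≡ suc (48 * k + 37)
  exact = solve-∀

even-half<odd-half : ∀ k {r} t → r ≤ 24 * k + 18 → 24 * k + 19 + r / 2 < 36 * k + 29 + t
even-half<odd-half k {r} t r≤ = begin-strict
  24 * k + 19 + r / 2        ≤⟨ +-monoʳ-≤ (24 * k + 19) (/2-≤ (≤24k+18⇒≤[12k+9]*2 k r≤)) ⟩
  24 * k + 19 + (12 * k + 9) <⟨ ≤-reflexive (gap k) ⟩
  36 * k + 29                ≤⟨ m≤m+n (36 * k + 29) t ⟩
  36 * k + 29 + t            ∎
  where
  open ≤-Reasoning
  gap : ∀ k → suc (24 * k + 19 + (12 * k + 9)) ≡ 36 * k + 29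
  gap = solve-∀

affine-c3-half : ∀ k {r} → r ≤ 24 * k + 18 → affine k (c3-half k r) ≡ σ-half k r
affine-c3-half k {r} r≤ with r % 2 in parity
... | zero  = affine-progression {a = 8 * k + 7} {b = 4 * k + 3} {x = 30 * k + 24} {d = 12 * k + 11}
                (2 * k + 2) (5 * k + 4) ([8k+7]*[12k+11]≡1+[2k+2]n k) (even-start k)
                (<-≤-trans (even-half<odd-half k (12 * k + 9) r≤) (≤-reflexive (36k+29+[12k+9]≡order k)))
  where
  even-start : ∀ k → (8 * k + 7) * (30 * k + 24) + (4 * k + 3) ≡ 24 * k + 19 + (5 * k + 4) * suc (48 * k + 37)
  even-start = solve-∀
... | suc _ = affine-progression {a = 8 * k + 7} {b = 4 * k + 3} {x = 24 * k + 20} {d = 12 * k + 11}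
                (2 * k + 2) (4 * k + 3) ([8k+7]*[12k+11]≡1+[2k+2]n k) (odd-start k)
                (<-≤-trans (+-monoʳ-< (36 * k + 29) (odd-/2-< parity (≤24k+18⇒≤[12k+9]*2 k r≤)))
                           (≤-reflexive (36k+29+[12k+9]≡order k)))
  where
  odd-start : ∀ k → (8 * k + 7) * (24 * k + 20) + (4 * k + 3) ≡ 36 * k + 29 + (4 * k + 3) * suc (48 * k + 37)
  odd-start = solve-∀

σ-half-range : ∀ k {r} → r ≤ 24 * k + 18 → 24 * k + 18 < σ-half k r × σ-half k r ≤ 48 * k + 37
σ-half-range k {r} r≤ =
  subst (_≤ σ-half k r) (+-suc (24 * k) 18) σ-half-lower ,
  subst (_≤ 48 * k + 37) (affine-c3-half k r≤) (m<1+n⇒m≤n (m%n<n ((8 * k + 7) * c3-half k r + (4 * k + 3)) (order k)))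
  where
  gap : ∀ k → 24 * k + 19 + (12 * k + 10) ≡ 36 * k + 29
  gap = solve-∀
  σ-half-lower : 24 * k + 19 ≤ σ-half k r
  σ-half-lower with r % 2
  ... | zero  = m≤m+n (24 * k + 19) (r / 2)
  ... | suc _ = ≤-trans (subst (24 * k + 19 ≤_) (gap k) (m≤m+n _ (12 * k + 10))) (m≤m+n (36 * k + 29) (r / 2))

σ-half-injective : ∀ k {r s} → r ≤ 24 * k + 18 → s ≤ 24 * k + 18 → σ-half k r ≡ σ-half k s → r ≡ s
σ-half-injective k {r} {s} r≤ s≤ eq with r % 2 in r-parity | s % 2 in s-parity
... | zero  | zero  = begin
  r         ≡⟨ %2≡0⇒≡[/2]*2 r r-parity ⟩
  r / 2 * 2 ≡⟨ cong (_* 2) (+-cancelˡ-≡ (24 * k + 19) (r / 2) (s / 2) eq) ⟩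
  s / 2 * 2 ≡⟨ %2≡0⇒≡[/2]*2 s s-parity ⟨
  s         ∎
  where open ≡-Reasoning
... | suc _ | suc _ = begin
  r             ≡⟨ %2≡suc⇒≡1+[/2]*2 r r-parity ⟩
  1 + r / 2 * 2 ≡⟨ cong (λ t → 1 + t * 2) (+-cancelˡ-≡ (36 * k + 29) (r / 2) (s / 2) eq) ⟩
  1 + s / 2 * 2 ≡⟨ %2≡suc⇒≡1+[/2]*2 s s-parity ⟨
  s             ∎
  where open ≡-Reasoning
... | zero  | suc _ = contradiction eq (<⇒≢ (even-half<odd-half k (s / 2) r≤))
... | suc _ | zero  = contradiction (sym eq) (<⇒≢ (even-half<odd-half k (r / 2) s≤))

48k+37≤1+[24k+18]+[24k+18] : ∀ k → 48 * k + 37 ≤ suc (24 * k + 18) + (24 * k + 18)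
48k+37≤1+[24k+18]+[24k+18] k = ≤-reflexive (halves k)
  where
  halves : ∀ k → 48 * k + 37 ≡ suc (24 * k + 18) + (24 * k + 18)
  halves = solve-∀

c3-half≤48k+37 : ∀ k r → c3-half k r ≤ 48 * k + 37
c3-half≤48k+37 k r with r % 2
... | zero  = m<1+n⇒m≤n (m%n<n (30 * k + 24 + r / 2 * (12 * k + 11)) (order k))
... | suc _ = m<1+n⇒m≤n (m%n<n (24 * k + 20 + r / 2 * (12 * k + 11)) (order k))

c3≡mirror : ∀ k r → c3 k r ≡ mirror (24 * k + 18) (48 * k + 37) (c3-half k) r
c3≡mirror k r with r ≤? 24 * k + 18
... | yes _ = refl
... | no  _ = refl

affine-c3 : ∀ k r → affine k (c3 k r) ≡ σ k r
affine-c3 k r = trans (cong (affine k) (c3≡mirror k r))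
  (mirror-conj (48k+37≤1+[24k+18]+[24k+18] k) {g = affine k} (affine-reflect-order k)
    (λ {r} _ → c3-half≤48k+37 k r) (affine-c3-half k) r)

σ-injective : ∀ k {r s} → r ≤ 48 * k + 37 → s ≤ 48 * k + 37 → σ k r ≡ σ k s → r ≡ s
σ-injective k = mirror-injective (48k+37≤1+[24k+18]+[24k+18] k) (σ-half-range k) (σ-half-injective k)

c3-injective : ∀ k {r s} → r < order k → s < order k → c3 k r % order k ≡ c3 k s % order k → r ≡ s
c3-injective k {r} {s} r<n s<n eq = σ-injective k (m<1+n⇒m≤n r<n) (m<1+n⇒m≤n s<n) (begin
  σ k r                       ≡⟨ affine-c3 k r ⟨
  affine k (c3 k r)           ≡⟨ [a*[x%n]+b]%n≡[a*x+b]%n (8 * k + 7) (4 * k + 3) (c3 k r) ⟨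
  affine k (c3 k r % order k) ≡⟨ cong (affine k) eq ⟩
  affine k (c3 k s % order k) ≡⟨ [a*[x%n]+b]%n≡[a*x+b]%n (8 * k + 7) (4 * k + 3) (c3 k s) ⟩
  affine k (c3 k s)           ≡⟨ affine-c3 k s ⟩
  σ k s                       ∎)
  where open ≡-Reasoning

lemma9 : (k : ℕ) → IsLatinSquare (order k) (L3 k)
lemma9 k = cyclicSquare-isLatin (order k) (c3 k) (c3-injective k)
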